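{- The map $\sigma_{\mathrm{sylv}} : \mathcal{A}^* \to S$, $\sigma_{\mathrm{sylv}}(u) = $ the shape of $\mathrm{dectree}(\mathrm{std}(u)^{ -1})$, where $S$ is the set of unlabelled binary trees, is an abstract shape.
   Context: $\mathcal{A} = \{1,2,3,\ldots\}$ with the usual order; $\mathcal{A}^*$ the free monoid over $\mathcal{A}$. $\mathrm{wt}(u) = (|u|_1,|u|_2,\ldots)$ where $|u|_a$ counts occurrences of $a$. The standardization $\mathrm{std}(u)$ of a word of length $k$ replaces occurrences of $1$ from left to right by $1,2,\ldots$, then occurrences of $2$ from left to right by the next integers, etc.; it is a permutation of $\{1,\ldots,k\}$ in one-line notation and $\mathrm{std}(u)^{ -1}$ is its inverse in one-line notation. For a word $w$ without repeated letters, $\mathrm{dectree}(w)$ is empty if $w = \varepsilon$, and otherwise, writing $w = sms'$ with $m$ the maximum letter, has root $m$, left subtree $\mathrm{dectree}(s)$ and right subtree $\mathrm{dectree}(s')$. The shape of a labelled binary tree is its underlying unlabelled rooted binary tree. An abstract shape is a map $\sigma : \mathcal{A}^* \to S$ such that (S1) $\sigma(u) = \sigma(\mathrm{std}(u))$ for all $u$, and (S2) for all $u,v \in \mathcal{A}^*$ and $a \in \mathcal{A}$, if $\mathrm{wt}(u)=\mathrm{wt}(v)$ and $\sigma(u)=\sigma(v)$, then $\sigma(ua)=\sigma(va)$ and $\sigma(au)=\sigma(av)$. -}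

module Defs where

open import Data.Nat using (ℕ; zero; suc; _+_; _≤_; _<ᵇ_; _≡ᵇ_; _⊔_)
open import Data.Bool using (Bool; true; false; if_then_else_; not)
open import Data.List using (List; []; _∷_; length; map; upTo; foldr; filter; take; span)
open import Data.List.Relation.Unary.All using (All)
open import Data.Maybe using (Maybe; just; nothing)
open import Data.Product using (_×_; _,_)
open import Relation.Binary.PropositionalEquality using (_≡_)

-- The alphabet 𝒜 = {1,2,3,...} with the usual order: letters are natural
-- numbers ≥ 1; a word of 𝒜* is a list of naturals all of which are ≥ 1.
Word : Set
Word = List ℕ

IsWord : Word → Set
IsWord u = All (λ a → 1 ≤ a) u

count : ℕ → Word → ℕ
count a []      = 0
count a (x ∷ u) = (if x ≡ᵇ a then 1 else 0) + count a u

SameWeight : Word → Word → Set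
SameWeight u v = ∀ (a : ℕ) → 1 ≤ a → count a u ≡ count a v

countLess : ℕ → Word → ℕ
countLess b []      = 0
countLess b (x ∷ u) = (if x <ᵇ b then 1 else 0) + countLess b u

-- The occurrences of the smallest letters receive the first
-- numbers and equal letters are numbered from left to right; hence the letter
-- at position i (0-based) receives the number
--   1 + #{letters of u smaller than u_i} + #{j < i : u_j = u_i}.
std-aux : Word → Word → Word → Word
std-aux u pre []       = []
std-aux u pre (x ∷ xs) =
  suc (countLess x u + count x pre) ∷ std-aux u (x ∷ pre) xs

std : Word → Word
std u = std-aux u [] u

-- 1-based position of the value j in w (length w + 1 if absent)
positionOf : ℕ → Word → ℕ
positionOf j []      = 1
positionOf j (x ∷ w) = if x ≡ᵇ j then 1 else suc (positionOf j w)

-- inverse of a permutation of {1..k} given in one-line notation,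
-- again in one-line notation: its j-th entry is the position of j in w
inverse : Word → Word
inverse w = map (λ i → positionOf (suc i) w) (upTo (length w))

data LTree : Set where
  lleaf : LTree
  lnode : LTree → ℕ → LTree → LTree

data Tree : Set where
  leaf : Tree
  node : Tree → Tree → Tree

shape : LTree → Tree
shape lleaf          = leaf
shape (lnode l _ r)  = node (shape l) (shape r)

maxLetter : Word → ℕ
maxLetter = foldr _⊔_ 0

-- decreasing tree, with a fuel argument (fuel = length w suffices, since
-- both parts s, s' of w = s m s' are strictly shorter than w)
-- splitAt m w = (s , s') if w = s m s' with m not in s; nothing if m ∉ w
splitAtLetter : ℕ → Word → Maybe (Word × Word)
splitAtLetter m []      = nothing
splitAtLetter m (x ∷ w) with x ≡ᵇ m
... | true  = just ([] , w)
... | false with splitAtLetter m w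
...   | nothing       = nothing
...   | just (s , s') = just (x ∷ s , s')

dectree-fuel : ℕ → Word → LTree
dectree-fuel _       []          = lleaf
dectree-fuel zero    (_ ∷ _)     = lleaf
dectree-fuel (suc n) w@(_ ∷ _)   with splitAtLetter (maxLetter w) w
... | nothing       = lleaf   -- impossible: the maximum occurs in a nonempty w
... | just (s , s') = lnode (dectree-fuel n s) (maxLetter w) (dectree-fuel n s')

dectree : Word → LTree
dectree w = dectree-fuel (length w) w

σsylv : Word → Tree
σsylv u = shape (dectree (inverse (std u)))

IsAbstractShape : {S : Set} → (Word → S) → Set
IsAbstractShape σ =
  (∀ (u : Word) → IsWord u → σ u ≡ σ (std u))
  × (∀ (u v : Word) (a : ℕ) → IsWord u → IsWord v → 1 ≤ a →
       SameWeight u v → σ u ≡ σ v →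
       (σ (u Data.List.++ (a ∷ [])) ≡ σ (v Data.List.++ (a ∷ [])))
       × (σ (a ∷ u) ≡ σ (a ∷ v)))

private
  open import Relation.Binary.PropositionalEquality using (refl)
  t1 : std (3 ∷ 1 ∷ 3 ∷ 2 ∷ 1 ∷ []) ≡ (4 ∷ 1 ∷ 5 ∷ 3 ∷ 2 ∷ [])
  t1 = refl
  t2 : inverse (4 ∷ 1 ∷ 5 ∷ 3 ∷ 2 ∷ []) ≡ (2 ∷ 5 ∷ 4 ∷ 1 ∷ 3 ∷ [])
  t2 = refl
  t3 : dectree (2 ∷ 5 ∷ 4 ∷ 1 ∷ 3 ∷ []) ≡ lnode (lnode lleaf 2 lleaf) 5 (lnode lleaf 4 (lnode (lnode lleaf 1 lleaf) 3 lleaf))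
  t3 = refl

module Submission where

-- Let c be the number of letters of u that are at most a.  Then std (u a) is std u with
-- every value above c shifted up by one, followed by c + 1; hence its inverse is the
-- inverse of std u with the new maximum inserted at position c.  The decreasing tree of
-- that word has the new maximum as root over the decreasing trees of the two halves, and
-- since prefixes and suffixes of a word correspond to in-order prefixes and suffixes of its
-- decreasing tree, σsylv (u a) is σsylv u split at in-order position c.  By induction
-- along u from the right, σsylv (a u) is σsylv u with a node inserted at in-order position
-- #{letters of u smaller than a}.  Both positions only depend on wt(u), which gives (S2);
-- (S1) follows from the first formula because standardization preserves these counts.

open import Defs
open import Data.Bool using (Bool; true; false; if_then_else_; T)
open import Data.Empty using (⊥-elim)
open import Data.List using (List; []; _∷_; _++_; length; take; drop; map; applyUpTo)
open import Data.List.Properties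
  using (length-++; length-map; length-applyUpTo; map-++; map-upTo; take-all; drop-all; take-[]; drop-[]; ++-conicalʳ)
open import Data.List.Relation.Unary.All using (All; []; _∷_)
import Data.List.Relation.Unary.All as All
open import Data.List.Relation.Unary.All.Properties using (++⁺; take⁺; drop⁺; map⁺; applyUpTo⁺₁)
open import Data.List.Reverse using (Reverse; []; _∶_∶ʳ_; reverseView)
open import Data.Maybe using (just; nothing)
open import Data.Nat
open import Data.Nat.Properties
open import Algebra.Properties.CommutativeSemigroup +-commutativeSemigroup using (interchange; xy∙z≈y∙xz)
open import Data.Product using (∃-syntax; _×_; _,_)
open import Function using (_∘_; case_of_)
open import Relation.Binary.Definitions using (tri<; tri≈; tri>)
open import Relation.Binary.PropositionalEquality
open import Relation.Nullary using (¬_; yes; no)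

T⇒≡true : ∀ {b} → T b → b ≡ true
T⇒≡true {true} _ = refl

¬T⇒≡false : ∀ {b} → ¬ T b → b ≡ false
¬T⇒≡false {false} _  = refl
¬T⇒≡false {true}  ¬t = ⊥-elim (¬t _)

≡ᵇ-refl : ∀ m → (m ≡ᵇ m) ≡ true
≡ᵇ-refl m = T⇒≡true (≡⇒≡ᵇ m m refl)

≢⇒≡ᵇ≡false : ∀ {m n} → m ≢ n → (m ≡ᵇ n) ≡ false
≢⇒≡ᵇ≡false m≢n = ¬T⇒≡false (m≢n ∘ ≡ᵇ⇒≡ _ _)

<⇒<ᵇ≡true : ∀ {m n} → m < n → (m <ᵇ n) ≡ true
<⇒<ᵇ≡true = T⇒≡true ∘ <⇒<ᵇ

≥⇒<ᵇ≡false : ∀ {m n} → n ≤ m → (m <ᵇ n) ≡ false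
≥⇒<ᵇ≡false n≤m = ¬T⇒≡false (≤⇒≯ n≤m ∘ <ᵇ⇒< _ _)

≤⇒≤ᵇ≡true : ∀ {m n} → m ≤ n → (m ≤ᵇ n) ≡ true
≤⇒≤ᵇ≡true = T⇒≡true ∘ ≤⇒≤ᵇ

>⇒≤ᵇ≡false : ∀ {m n} → n < m → (m ≤ᵇ n) ≡ false
>⇒≤ᵇ≡false n<m = ¬T⇒≡false (<⇒≱ n<m ∘ ≤ᵇ⇒≤ _ _)

module _ {A : Set} where

  length-++-∷ : ∀ (xs : List A) {y ys} → length (xs ++ y ∷ ys) ≡ suc (length xs + length ys)
  length-++-∷ xs {y} {ys} = trans (length-++ xs) (+-suc (length xs) (length ys))

  take-++ˡ : ∀ {j} (xs : List A) {ys} → j ≤ length xs → take j (xs ++ ys) ≡ take j xs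
  take-++ˡ []       z≤n     = refl
  take-++ˡ (x ∷ xs) z≤n     = refl
  take-++ˡ (x ∷ xs) (s≤s j≤) = cong (x ∷_) (take-++ˡ xs j≤)

  drop-++ˡ : ∀ {j} (xs : List A) {ys} → j ≤ length xs → drop j (xs ++ ys) ≡ drop j xs ++ ys
  drop-++ˡ []       z≤n     = refl
  drop-++ˡ (x ∷ xs) z≤n     = refl
  drop-++ˡ (x ∷ xs) (s≤s j≤) = drop-++ˡ xs j≤

  take-++ʳ : ∀ (xs : List A) {ys} j → take (length xs + j) (xs ++ ys) ≡ xs ++ take j ys
  take-++ʳ []       j = refl
  take-++ʳ (x ∷ xs) j = cong (x ∷_) (take-++ʳ xs j)

  drop-++ʳ : ∀ (xs : List A) {ys} j → drop (length xs + j) (xs ++ ys) ≡ drop j ys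
  drop-++ʳ []       j = refl
  drop-++ʳ (x ∷ xs) j = drop-++ʳ xs j

  take-length-++ : ∀ (xs : List A) {ys} → take (length xs) (xs ++ ys) ≡ xs
  take-length-++ xs = trans (take-++ˡ xs ≤-refl) (take-all (length xs) xs ≤-refl)

  drop-length-++ : ∀ (xs : List A) {ys} → drop (length xs) (xs ++ ys) ≡ ys
  drop-length-++ xs {ys} = trans (drop-++ˡ xs ≤-refl) (cong (_++ ys) (drop-all (length xs) xs ≤-refl))

  applyUpTo-+ : ∀ (f : ℕ → A) m n → applyUpTo f (m + n) ≡ applyUpTo f m ++ applyUpTo (f ∘ (m +_)) n
  applyUpTo-+ f zero    n = refl
  applyUpTo-+ f (suc m) n = cong (f 0 ∷_) (applyUpTo-+ (f ∘ suc) m n)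

  applyUpTo-cong : ∀ {f g : ℕ → A} n → (∀ {i} → i < n → f i ≡ g i) → applyUpTo f n ≡ applyUpTo g n
  applyUpTo-cong zero    f≡g = refl
  applyUpTo-cong (suc n) f≡g = cong₂ _∷_ (f≡g z<s) (applyUpTo-cong n (f≡g ∘ s<s))

  snoc-induction : (P : List A → Set) → P [] → (∀ xs x → P xs → P (xs ++ x ∷ [])) → ∀ xs → P xs
  snoc-induction P base step xs = go (reverseView xs)
    where
    go : ∀ {xs} → Reverse xs → P xs
    go []               = base
    go (xs ∶ xs′ ∶ʳ x) = step xs x (go xs′)

size : Tree → ℕ
size leaf       = 0
size (node l r) = size l + suc (size r)

-- Nodes are numbered 0, 1, … in in-order: takeT j t is the shape of the first j nodes,
-- dropT j t that of the others, and insertT k t adds a node at position k.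
takeT : ℕ → Tree → Tree
takeT j leaf       = leaf
takeT j (node l r) =
  if j ≤ᵇ size l then takeT j l else node l (takeT (j ∸ suc (size l)) r)

dropT : ℕ → Tree → Tree
dropT j leaf       = leaf
dropT j (node l r) =
  if j ≤ᵇ size l then node (dropT j l) r else dropT (j ∸ suc (size l)) r

insertT : ℕ → Tree → Tree
insertT k leaf       = node leaf leaf
insertT k (node l r) =
  if k ≤ᵇ size l then node (insertT k l) r else node l (insertT (k ∸ suc (size l)) r)

splitT : ℕ → Tree → Tree
splitT c t = node (takeT c t) (dropT c t)

data Side (n j : ℕ) : Set where
  left  : j ≤ n → Side n j
  right : ∀ d → j ≡ suc (n + d) → Side n j

side : ∀ n j → Side n j
side n j with j ≤? n
... | yes j≤n = left j≤n
... | no  j≰n = right (j ∸ suc n) (sym (m+[n∸m]≡n (≰⇒> j≰n)))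

module _ {l r : Tree} where

  takeT-left : ∀ {j} → j ≤ size l → takeT j (node l r) ≡ takeT j l
  takeT-left j≤ rewrite ≤⇒≤ᵇ≡true j≤ = refl

  takeT-right : ∀ {j} d → j ≡ suc (size l + d) → takeT j (node l r) ≡ node l (takeT d r)
  takeT-right d refl rewrite >⇒≤ᵇ≡false (s≤s (m≤m+n (size l) d)) | m+n∸m≡n (size l) d = refl

  dropT-left : ∀ {j} → j ≤ size l → dropT j (node l r) ≡ node (dropT j l) r
  dropT-left j≤ rewrite ≤⇒≤ᵇ≡true j≤ = refl

  dropT-right : ∀ {j} d → j ≡ suc (size l + d) → dropT j (node l r) ≡ dropT d r
  dropT-right d refl rewrite >⇒≤ᵇ≡false (s≤s (m≤m+n (size l) d)) | m+n∸m≡n (size l) d = refl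

  insertT-left : ∀ {k} → k ≤ size l → insertT k (node l r) ≡ node (insertT k l) r
  insertT-left k≤ rewrite ≤⇒≤ᵇ≡true k≤ = refl

  insertT-right : ∀ {j} d → j ≡ suc (size l + d) → insertT j (node l r) ≡ node l (insertT d r)
  insertT-right d refl rewrite >⇒≤ᵇ≡false (s≤s (m≤m+n (size l) d)) | m+n∸m≡n (size l) d = refl

size-insertT : ∀ k t → size (insertT k t) ≡ suc (size t)
size-insertT k leaf = refl
size-insertT k (node l r) with side (size l) k
... | left k≤ = begin
  size (insertT k (node l r))      ≡⟨ cong size (insertT-left {l} {r} k≤) ⟩
  size (insertT k l) + suc (size r) ≡⟨ cong (_+ suc (size r)) (size-insertT k l) ⟩
  suc (size l + suc (size r))       ∎
  where open ≡-Reasoning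
... | right d refl = begin
  size (insertT (suc (size l + d)) (node l r)) ≡⟨ cong size (insertT-right {l} {r} d refl) ⟩
  size l + suc (size (insertT d r))            ≡⟨ cong (λ x → size l + suc x) (size-insertT d r) ⟩
  size l + suc (suc (size r))                  ≡⟨ +-suc (size l) (suc (size r)) ⟩
  suc (size l + suc (size r))                  ∎
  where open ≡-Reasoning

size≤size-insertT : ∀ k t → size t ≤ size (insertT k t)
size≤size-insertT k t = ≤-trans (n≤1+n _) (≤-reflexive (sym (size-insertT k t)))

right-offset-≤ : ∀ {n d m} → suc (n + d) ≤ n + suc m → d ≤ m
right-offset-≤ {n} {d} {m} p = ≤-pred (+-cancelˡ-≤ n _ _ (subst (_≤ n + suc m) (sym (+-suc n d)) p))

size-takeT : ∀ c t → c ≤ size t → size (takeT c t) ≡ c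
size-takeT _ leaf z≤n = refl
size-takeT c (node l r) c≤ with side (size l) c
... | left c≤l = trans (cong size (takeT-left {l} {r} c≤l)) (size-takeT c l c≤l)
... | right d refl = begin
  size (takeT (suc (size l + d)) (node l r)) ≡⟨ cong size (takeT-right {l} {r} d refl) ⟩
  size l + suc (size (takeT d r))            ≡⟨ cong (λ x → size l + suc x) (size-takeT d r (right-offset-≤ c≤)) ⟩
  size l + suc d                             ≡⟨ +-suc (size l) d ⟩
  suc (size l + d)                           ∎
  where open ≡-Reasoning

size-dropT : ∀ c t → c ≤ size t → c + size (dropT c t) ≡ size t
size-dropT _ leaf z≤n = refl
size-dropT c (node l r) c≤ with side (size l) c
... | left c≤l = begin
  c + size (dropT c (node l r))        ≡⟨ cong (λ x → c + size x) (dropT-left {l} {r} c≤l) ⟩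
  c + (size (dropT c l) + suc (size r)) ≡⟨ +-assoc c _ _ ⟨
  c + size (dropT c l) + suc (size r)   ≡⟨ cong (_+ suc (size r)) (size-dropT c l c≤l) ⟩
  size l + suc (size r)                 ∎
  where open ≡-Reasoning
... | right d refl = begin
  suc (size l + d) + size (dropT (suc (size l + d)) (node l r)) ≡⟨ cong (λ x → suc (size l + d) + size x) (dropT-right {l} {r} d refl) ⟩
  suc (size l + d) + size (dropT d r)                          ≡⟨ cong suc (+-assoc (size l) d _) ⟩
  suc (size l + (d + size (dropT d r)))                        ≡⟨ cong (λ x → suc (size l + x)) (size-dropT d r (right-offset-≤ c≤)) ⟩
  suc (size l + size r)                                        ≡⟨ +-suc (size l) (size r) ⟨
  size l + suc (size r)                                        ∎
  where open ≡-Reasoning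

takeT-insertT-≤ : ∀ k c t → k ≤ c → c ≤ size t → takeT (suc c) (insertT k t) ≡ insertT k (takeT c t)
takeT-insertT-≤ _ _ leaf z≤n z≤n = refl
takeT-insertT-≤ k c (node l r) k≤c c≤ with side (size l) k | side (size l) c
... | left k≤l | left c≤l = begin
  takeT (suc c) (insertT k (node l r)) ≡⟨ cong (takeT (suc c)) (insertT-left {l} {r} k≤l) ⟩
  takeT (suc c) (node (insertT k l) r) ≡⟨ takeT-left {insertT k l} {r} (subst (suc c ≤_) (sym (size-insertT k l)) (s≤s c≤l)) ⟩
  takeT (suc c) (insertT k l)          ≡⟨ takeT-insertT-≤ k c l k≤c c≤l ⟩
  insertT k (takeT c l)                ≡⟨ cong (insertT k) (takeT-left {l} {r} c≤l) ⟨
  insertT k (takeT c (node l r))       ∎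
  where open ≡-Reasoning
... | left k≤l | right d refl = begin
  takeT (suc c) (insertT k (node l r)) ≡⟨ cong (takeT (suc c)) (insertT-left {l} {r} k≤l) ⟩
  takeT (suc c) (node (insertT k l) r) ≡⟨ takeT-right {insertT k l} {r} d (cong (λ n → suc (n + d)) (sym (size-insertT k l))) ⟩
  node (insertT k l) (takeT d r)       ≡⟨ insertT-left {l} {takeT d r} k≤l ⟨
  insertT k (node l (takeT d r))       ≡⟨ cong (insertT k) (takeT-right {l} {r} d refl) ⟨
  insertT k (takeT c (node l r))       ∎
  where open ≡-Reasoning
... | right _ refl | left c≤l = ⊥-elim (<⇒≱ (s≤s (m≤m+n _ _)) (≤-trans k≤c c≤l))
... | right dk refl | right dc refl = begin
  takeT (suc c) (insertT k (node l r))   ≡⟨ cong (takeT (suc c)) (insertT-right {l} {r} dk refl) ⟩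
  takeT (suc c) (node l (insertT dk r))  ≡⟨ takeT-right {l} {insertT dk r} (suc dc) (cong suc (sym (+-suc (size l) dc))) ⟩
  node l (takeT (suc dc) (insertT dk r)) ≡⟨ cong (node l) (takeT-insertT-≤ dk dc r (+-cancelˡ-≤ (size l) _ _ (≤-pred k≤c)) (right-offset-≤ c≤)) ⟩
  node l (insertT dk (takeT dc r))       ≡⟨ insertT-right {l} {takeT dc r} dk refl ⟨
  insertT k (node l (takeT dc r))        ≡⟨ cong (insertT k) (takeT-right {l} {r} dc refl) ⟨
  insertT k (takeT c (node l r))         ∎
  where open ≡-Reasoning

dropT-insertT-≤ : ∀ k c t → k ≤ c → c ≤ size t → dropT (suc c) (insertT k t) ≡ dropT c t
dropT-insertT-≤ _ _ leaf z≤n z≤n = refl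
dropT-insertT-≤ k c (node l r) k≤c c≤ with side (size l) k | side (size l) c
... | left k≤l | left c≤l = begin
  dropT (suc c) (insertT k (node l r)) ≡⟨ cong (dropT (suc c)) (insertT-left {l} {r} k≤l) ⟩
  dropT (suc c) (node (insertT k l) r) ≡⟨ dropT-left {insertT k l} {r} (subst (suc c ≤_) (sym (size-insertT k l)) (s≤s c≤l)) ⟩
  node (dropT (suc c) (insertT k l)) r ≡⟨ cong (λ x → node x r) (dropT-insertT-≤ k c l k≤c c≤l) ⟩
  node (dropT c l) r                   ≡⟨ dropT-left {l} {r} c≤l ⟨
  dropT c (node l r)                   ∎
  where open ≡-Reasoning
... | left k≤l | right d refl = begin
  dropT (suc c) (insertT k (node l r)) ≡⟨ cong (dropT (suc c)) (insertT-left {l} {r} k≤l) ⟩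
  dropT (suc c) (node (insertT k l) r) ≡⟨ dropT-right {insertT k l} {r} d (cong (λ n → suc (n + d)) (sym (size-insertT k l))) ⟩
  dropT d r                            ≡⟨ dropT-right {l} {r} d refl ⟨
  dropT c (node l r)                   ∎
  where open ≡-Reasoning
... | right _ refl | left c≤l = ⊥-elim (<⇒≱ (s≤s (m≤m+n _ _)) (≤-trans k≤c c≤l))
... | right dk refl | right dc refl = begin
  dropT (suc c) (insertT k (node l r))  ≡⟨ cong (dropT (suc c)) (insertT-right {l} {r} dk refl) ⟩
  dropT (suc c) (node l (insertT dk r)) ≡⟨ dropT-right {l} {insertT dk r} (suc dc) (cong suc (sym (+-suc (size l) dc))) ⟩
  dropT (suc dc) (insertT dk r)         ≡⟨ dropT-insertT-≤ dk dc r (+-cancelˡ-≤ (size l) _ _ (≤-pred k≤c)) (right-offset-≤ c≤) ⟩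
  dropT dc r                            ≡⟨ dropT-right {l} {r} dc refl ⟨
  dropT c (node l r)                    ∎
  where open ≡-Reasoning

takeT-insertT-+ : ∀ c e t → c ≤ size t → takeT c (insertT (c + e) t) ≡ takeT c t
takeT-insertT-+ _ _ leaf z≤n = refl
takeT-insertT-+ c e (node l r) c≤ with side (size l) c
... | right dc refl = begin
  takeT c (insertT (c + e) (node l r))  ≡⟨ cong (takeT c) (insertT-right {l} {r} (dc + e) (cong suc (+-assoc (size l) dc e))) ⟩
  takeT c (node l (insertT (dc + e) r)) ≡⟨ takeT-right {l} {insertT (dc + e) r} dc refl ⟩
  node l (takeT dc (insertT (dc + e) r)) ≡⟨ cong (node l) (takeT-insertT-+ dc e r (right-offset-≤ c≤)) ⟩
  node l (takeT dc r)                    ≡⟨ takeT-right {l} {r} dc refl ⟨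
  takeT c (node l r)                     ∎
  where open ≡-Reasoning
... | left c≤l with side (size l) (c + e)
...   | left k≤l = begin
  takeT c (insertT (c + e) (node l r)) ≡⟨ cong (takeT c) (insertT-left {l} {r} k≤l) ⟩
  takeT c (node (insertT (c + e) l) r) ≡⟨ takeT-left {insertT (c + e) l} {r} (≤-trans c≤l (size≤size-insertT (c + e) l)) ⟩
  takeT c (insertT (c + e) l)          ≡⟨ takeT-insertT-+ c e l c≤l ⟩
  takeT c l                            ≡⟨ takeT-left {l} {r} c≤l ⟨
  takeT c (node l r)                   ∎
  where open ≡-Reasoning
...   | right dk k≡ = begin
  takeT c (insertT (c + e) (node l r)) ≡⟨ cong (takeT c) (insertT-right {l} {r} dk k≡) ⟩
  takeT c (node l (insertT dk r))      ≡⟨ takeT-left {l} {insertT dk r} c≤l ⟩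
  takeT c l                            ≡⟨ takeT-left {l} {r} c≤l ⟨
  takeT c (node l r)                   ∎
  where open ≡-Reasoning

dropT-insertT-+ : ∀ c e t → c ≤ size t → dropT c (insertT (c + e) t) ≡ insertT e (dropT c t)
dropT-insertT-+ _ _ leaf z≤n = refl
dropT-insertT-+ c e (node l r) c≤ with side (size l) c
... | right dc refl = begin
  dropT c (insertT (c + e) (node l r))  ≡⟨ cong (dropT c) (insertT-right {l} {r} (dc + e) (cong suc (+-assoc (size l) dc e))) ⟩
  dropT c (node l (insertT (dc + e) r)) ≡⟨ dropT-right {l} {insertT (dc + e) r} dc refl ⟩
  dropT dc (insertT (dc + e) r)         ≡⟨ dropT-insertT-+ dc e r (right-offset-≤ c≤) ⟩
  insertT e (dropT dc r)                ≡⟨ cong (insertT e) (dropT-right {l} {r} dc refl) ⟨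
  insertT e (dropT c (node l r))        ∎
  where open ≡-Reasoning
... | left c≤l with side (size l) (c + e)
...   | left k≤l = begin
  dropT c (insertT (c + e) (node l r)) ≡⟨ cong (dropT c) (insertT-left {l} {r} k≤l) ⟩
  dropT c (node (insertT (c + e) l) r) ≡⟨ dropT-left {insertT (c + e) l} {r} (≤-trans c≤l (size≤size-insertT (c + e) l)) ⟩
  node (dropT c (insertT (c + e) l)) r ≡⟨ cong (λ x → node x r) (dropT-insertT-+ c e l c≤l) ⟩
  node (insertT e (dropT c l)) r       ≡⟨ insertT-left {dropT c l} {r} e≤ ⟨
  insertT e (node (dropT c l) r)       ≡⟨ cong (insertT e) (dropT-left {l} {r} c≤l) ⟨
  insertT e (dropT c (node l r))       ∎
  where
  open ≡-Reasoning
  e≤ : e ≤ size (dropT c l)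
  e≤ = +-cancelˡ-≤ c _ _ (≤-trans k≤l (≤-reflexive (sym (size-dropT c l c≤l))))
...   | right dk k≡ = begin
  dropT c (insertT (c + e) (node l r)) ≡⟨ cong (dropT c) (insertT-right {l} {r} dk k≡) ⟩
  dropT c (node l (insertT dk r))      ≡⟨ dropT-left {l} {insertT dk r} c≤l ⟩
  node (dropT c l) (insertT dk r)      ≡⟨ insertT-right {dropT c l} {r} dk e≡ ⟨
  insertT e (node (dropT c l) r)       ≡⟨ cong (insertT e) (dropT-left {l} {r} c≤l) ⟨
  insertT e (dropT c (node l r))       ∎
  where
  open ≡-Reasoning
  e≡ : e ≡ suc (size (dropT c l) + dk)
  e≡ = +-cancelˡ-≡ c _ _ (begin
    c + e                              ≡⟨ k≡ ⟩
    suc (size l + dk)                  ≡⟨ cong (λ n → suc (n + dk)) (size-dropT c l c≤l) ⟨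
    suc (c + size (dropT c l) + dk)    ≡⟨ cong suc (+-assoc c _ dk) ⟩
    suc (c + (size (dropT c l) + dk))  ≡⟨ +-suc c _ ⟨
    c + suc (size (dropT c l) + dk)    ∎)

splitT-insertT-≤ : ∀ k c t → k ≤ c → c ≤ size t → splitT (suc c) (insertT k t) ≡ insertT k (splitT c t)
splitT-insertT-≤ k c t k≤c c≤ = begin
  node (takeT (suc c) (insertT k t)) (dropT (suc c) (insertT k t))
    ≡⟨ cong₂ node (takeT-insertT-≤ k c t k≤c c≤) (dropT-insertT-≤ k c t k≤c c≤) ⟩
  node (insertT k (takeT c t)) (dropT c t)
    ≡⟨ insertT-left {takeT c t} {dropT c t} (subst (k ≤_) (sym (size-takeT c t c≤)) k≤c) ⟨
  insertT k (splitT c t) ∎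
  where open ≡-Reasoning

splitT-insertT-≥ : ∀ k c t → c ≤ k → c ≤ size t → splitT c (insertT k t) ≡ insertT (suc k) (splitT c t)
splitT-insertT-≥ k c t c≤k c≤ = subst (λ k → splitT c (insertT k t) ≡ insertT (suc k) (splitT c t)) (m+[n∸m]≡n c≤k) (begin
  node (takeT c (insertT (c + e) t)) (dropT c (insertT (c + e) t))
    ≡⟨ cong₂ node (takeT-insertT-+ c e t c≤) (dropT-insertT-+ c e t c≤) ⟩
  node (takeT c t) (insertT e (dropT c t))
    ≡⟨ insertT-right {takeT c t} {dropT c t} e (cong (λ n → suc (n + e)) (sym (size-takeT c t c≤))) ⟨
  insertT (suc (c + e)) (splitT c t) ∎)
  where
  open ≡-Reasoning
  e = k ∸ c

-- Decreasing trees

maxLetter-≤ : ∀ {m} w → All (_≤ m) w → maxLetter w ≤ m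
maxLetter-≤ []      []         = z≤n
maxLetter-≤ (x ∷ w) (x≤ ∷ w≤) = ⊔-lub x≤ (maxLetter-≤ w w≤)

≤-maxLetter-++-∷ : ∀ s {m s'} → m ≤ maxLetter (s ++ m ∷ s')
≤-maxLetter-++-∷ []      = m≤m⊔n _ _
≤-maxLetter-++-∷ (x ∷ s) = ≤-trans (≤-maxLetter-++-∷ s) (m≤n⊔m x _)

maxLetter-++-∷ : ∀ {m} s s' → All (_< m) s → All (_≤ m) s' → maxLetter (s ++ m ∷ s') ≡ m
maxLetter-++-∷ s s' s< s'≤ =
  ≤-antisym (maxLetter-≤ (s ++ _ ∷ s') (++⁺ (All.map <⇒≤ s<) (≤-refl ∷ s'≤))) (≤-maxLetter-++-∷ s)

splitAtLetter-++-∷ : ∀ {m} s s' → All (_< m) s → splitAtLetter m (s ++ m ∷ s') ≡ just (s , s')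
splitAtLetter-++-∷ {m} []      s' []         rewrite ≡ᵇ-refl m = refl
splitAtLetter-++-∷         (x ∷ s) s' (x< ∷ s<) rewrite ≢⇒≡ᵇ≡false (<⇒≢ x<) | splitAtLetter-++-∷ s s' s< = refl

splitAtLetter-length : ∀ m w {s s'} → splitAtLetter m w ≡ just (s , s') → suc (length s + length s') ≡ length w
splitAtLetter-length m (x ∷ w) eq with x ≡ᵇ m
splitAtLetter-length m (x ∷ w) refl | true = refl
... | false with splitAtLetter m w in eq'
splitAtLetter-length m (x ∷ w) refl | false | just (t , t') = cong suc (splitAtLetter-length m w eq')

splitAtLetter-shorter : ∀ m w {s s'} → splitAtLetter m w ≡ just (s , s') → length s < length w × length s' < length w
splitAtLetter-shorter m w {s} {s'} eq =
    ≤-trans (s≤s (m≤m+n _ _)) (≤-reflexive (splitAtLetter-length m w eq))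
  , ≤-trans (s≤s (m≤n+m _ _)) (≤-reflexive (splitAtLetter-length m w eq))

dectree-fuel-irrelevant : ∀ n k w → length w ≤ n → length w ≤ k → dectree-fuel n w ≡ dectree-fuel k w
dectree-fuel-irrelevant _       _       []      _   _   = refl
dectree-fuel-irrelevant (suc n) (suc k) (x ∷ w) w≤n w≤k with splitAtLetter (maxLetter (x ∷ w)) (x ∷ w) in eq
... | nothing       = refl
... | just (s , s') with splitAtLetter-shorter (maxLetter (x ∷ w)) (x ∷ w) eq
...   | s< , s'< = cong₂ (λ t t' → lnode t (maxLetter (x ∷ w)) t')
        (dectree-fuel-irrelevant n k s (≤-pred (≤-trans s< w≤n)) (≤-pred (≤-trans s< w≤k)))
        (dectree-fuel-irrelevant n k s' (≤-pred (≤-trans s'< w≤n)) (≤-pred (≤-trans s'< w≤k)))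

dectree-fuel-∷ : ∀ n x w {s s'} → splitAtLetter (maxLetter (x ∷ w)) (x ∷ w) ≡ just (s , s') →
                 dectree-fuel (suc n) (x ∷ w) ≡ lnode (dectree-fuel n s) (maxLetter (x ∷ w)) (dectree-fuel n s')
dectree-fuel-∷ n x w eq rewrite eq = refl

dectree-∷ : ∀ x w {s s'} → splitAtLetter (maxLetter (x ∷ w)) (x ∷ w) ≡ just (s , s') →
            dectree (x ∷ w) ≡ lnode (dectree s) (maxLetter (x ∷ w)) (dectree s')
dectree-∷ x w {s} {s'} eq with splitAtLetter-shorter (maxLetter (x ∷ w)) (x ∷ w) eq
... | s< , s'< = trans (dectree-fuel-∷ (length w) x w eq) (cong₂ (λ t t' → lnode t (maxLetter (x ∷ w)) t')
  (dectree-fuel-irrelevant (length w) (length s) s (≤-pred s<) ≤-refl)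
  (dectree-fuel-irrelevant (length w) (length s') s' (≤-pred s'<) ≤-refl))

dectree-++-∷ : ∀ {m} s s' → All (_< m) s → All (_≤ m) s' → dectree (s ++ m ∷ s') ≡ lnode (dectree s) m (dectree s')
dectree-++-∷ {m} s s' s< s'≤ with s ++ m ∷ s' in w≡
... | []    = case ++-conicalʳ s (m ∷ s') w≡ of λ ()
... | x ∷ w = begin
  dectree (x ∷ w)                                   ≡⟨ dectree-∷ x w split≡ ⟩
  lnode (dectree s) (maxLetter (x ∷ w)) (dectree s') ≡⟨ cong (λ k → lnode (dectree s) k (dectree s')) max≡ ⟩
  lnode (dectree s) m (dectree s')                  ∎
  where
  open ≡-Reasoning
  max≡ : maxLetter (x ∷ w) ≡ m
  max≡ = subst (λ v → maxLetter v ≡ m) w≡ (maxLetter-++-∷ s s' s< s'≤)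
  split≡ : splitAtLetter (maxLetter (x ∷ w)) (x ∷ w) ≡ just (s , s')
  split≡ = subst (λ v → splitAtLetter (maxLetter v) v ≡ just (s , s')) w≡
             (trans (cong (λ k → splitAtLetter k (s ++ m ∷ s')) (maxLetter-++-∷ s s' s< s'≤)) (splitAtLetter-++-∷ s s' s<))

MaxSplit : Word → Set
MaxSplit w = ∃[ m ] ∃[ s ] ∃[ s' ] w ≡ s ++ m ∷ s' × All (_< m) s × All (_≤ m) s'

maxSplit : ∀ x w → MaxSplit (x ∷ w)
maxSplit x []      = x , [] , [] , refl , [] , []
maxSplit x (y ∷ w) with maxSplit y w
... | m , s , s' , w≡ , s< , s'≤ with x <? m
...   | yes x<m = m , x ∷ s , s' , cong (x ∷_) w≡ , x<m ∷ s< , s'≤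
...   | no  x≮m = x , [] , y ∷ w , refl , [] , subst (All (_≤ x)) (sym w≡)
                    (All.map (λ v≤m → ≤-trans v≤m (≮⇒≥ x≮m)) (++⁺ (All.map <⇒≤ s<) (≤-refl ∷ s'≤)))

dectree-induction : (P : Word → Set) → P [] →
  (∀ {m} s s' → All (_< m) s → All (_≤ m) s' → P s → P s' → P (s ++ m ∷ s')) →
  ∀ w → P w
dectree-induction P base step w = go (length w) w ≤-refl
  where
  go : ∀ n w → length w ≤ n → P w
  go _       []      _    = base
  go (suc n) (x ∷ w) w≤n with maxSplit x w
  ... | m , s , s' , w≡ , s< , s'≤ = subst P (sym w≡) (step s s' s< s'≤ (go n s s≤n) (go n s' s'≤n))
    where
    split≤n : suc (length s + length s') ≤ suc n
    split≤n = ≤-trans (≤-reflexive (trans (sym (length-++-∷ s)) (cong length (sym w≡)))) w≤n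
    s≤n : length s ≤ n
    s≤n = ≤-pred (≤-trans (s≤s (m≤m+n _ _)) split≤n)
    s'≤n : length s' ≤ n
    s'≤n = ≤-pred (≤-trans (s≤s (m≤n+m _ _)) split≤n)

decShape : Word → Tree
decShape w = shape (dectree w)

decShape-++-∷ : ∀ {m} s s' → All (_< m) s → All (_≤ m) s' → decShape (s ++ m ∷ s') ≡ node (decShape s) (decShape s')
decShape-++-∷ s s' s< s'≤ = cong shape (dectree-++-∷ s s' s< s'≤)

size-decShape : ∀ w → size (decShape w) ≡ length w
size-decShape = dectree-induction (λ w → size (decShape w) ≡ length w) refl step
  where
  step : ∀ {m} s s' → All (_< m) s → All (_≤ m) s' →
         size (decShape s) ≡ length s → size (decShape s') ≡ length s' →
         size (decShape (s ++ m ∷ s')) ≡ length (s ++ m ∷ s')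
  step {m} s s' s< s'≤ ih ih' = begin
    size (decShape (s ++ m ∷ s'))                 ≡⟨ cong size (decShape-++-∷ s s' s< s'≤) ⟩
    size (decShape s) + suc (size (decShape s')) ≡⟨ cong₂ (λ a b → a + suc b) ih ih' ⟩
    length s + suc (length s')                   ≡⟨ length-++ s ⟨
    length (s ++ m ∷ s')                         ∎
    where open ≡-Reasoning

decShape-take : ∀ w j → decShape (take j w) ≡ takeT j (decShape w)
decShape-take = dectree-induction (λ w → ∀ j → decShape (take j w) ≡ takeT j (decShape w)) (λ j → cong decShape (take-[] j)) step
  where
  step : ∀ {m} s s' → All (_< m) s → All (_≤ m) s' →
         (∀ j → decShape (take j s) ≡ takeT j (decShape s)) → (∀ j → decShape (take j s') ≡ takeT j (decShape s')) →
         ∀ j → decShape (take j (s ++ m ∷ s')) ≡ takeT j (decShape (s ++ m ∷ s'))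
  step {m} s s' s< s'≤ ih ih' j with side (length s) j
  ... | left j≤ = begin
    decShape (take j (s ++ m ∷ s'))                 ≡⟨ cong decShape (take-++ˡ s j≤) ⟩
    decShape (take j s)                             ≡⟨ ih j ⟩
    takeT j (decShape s)                            ≡⟨ takeT-left {decShape s} {decShape s'} (subst (j ≤_) (sym (size-decShape s)) j≤) ⟨
    takeT j (node (decShape s) (decShape s'))       ≡⟨ cong (takeT j) (decShape-++-∷ s s' s< s'≤) ⟨
    takeT j (decShape (s ++ m ∷ s'))                ∎
    where open ≡-Reasoning
  ... | right d refl = begin
    decShape (take j (s ++ m ∷ s'))                 ≡⟨ cong (λ n → decShape (take n (s ++ m ∷ s'))) (+-suc (length s) d) ⟨
    decShape (take (length s + suc d) (s ++ m ∷ s')) ≡⟨ cong decShape (take-++ʳ s (suc d)) ⟩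
    decShape (s ++ m ∷ take d s')                   ≡⟨ decShape-++-∷ s (take d s') s< (take⁺ d s'≤) ⟩
    node (decShape s) (decShape (take d s'))        ≡⟨ cong (node (decShape s)) (ih' d) ⟩
    node (decShape s) (takeT d (decShape s'))       ≡⟨ takeT-right {decShape s} {decShape s'} d (cong (λ n → suc (n + d)) (sym (size-decShape s))) ⟨
    takeT j (node (decShape s) (decShape s'))       ≡⟨ cong (takeT j) (decShape-++-∷ s s' s< s'≤) ⟨
    takeT j (decShape (s ++ m ∷ s'))                ∎
    where open ≡-Reasoning

decShape-drop : ∀ w j → decShape (drop j w) ≡ dropT j (decShape w)
decShape-drop = dectree-induction (λ w → ∀ j → decShape (drop j w) ≡ dropT j (decShape w)) (λ j → cong decShape (drop-[] j)) step
  where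
  step : ∀ {m} s s' → All (_< m) s → All (_≤ m) s' →
         (∀ j → decShape (drop j s) ≡ dropT j (decShape s)) → (∀ j → decShape (drop j s') ≡ dropT j (decShape s')) →
         ∀ j → decShape (drop j (s ++ m ∷ s')) ≡ dropT j (decShape (s ++ m ∷ s'))
  step {m} s s' s< s'≤ ih ih' j with side (length s) j
  ... | left j≤ = begin
    decShape (drop j (s ++ m ∷ s'))                 ≡⟨ cong decShape (drop-++ˡ s j≤) ⟩
    decShape (drop j s ++ m ∷ s')                   ≡⟨ decShape-++-∷ (drop j s) s' (drop⁺ j s<) s'≤ ⟩
    node (decShape (drop j s)) (decShape s')        ≡⟨ cong (λ t → node t (decShape s')) (ih j) ⟩
    node (dropT j (decShape s)) (decShape s')       ≡⟨ dropT-left {decShape s} {decShape s'} (subst (j ≤_) (sym (size-decShape s)) j≤) ⟨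
    dropT j (node (decShape s) (decShape s'))       ≡⟨ cong (dropT j) (decShape-++-∷ s s' s< s'≤) ⟨
    dropT j (decShape (s ++ m ∷ s'))                ∎
    where open ≡-Reasoning
  ... | right d refl = begin
    decShape (drop j (s ++ m ∷ s'))                 ≡⟨ cong (λ n → decShape (drop n (s ++ m ∷ s'))) (+-suc (length s) d) ⟨
    decShape (drop (length s + suc d) (s ++ m ∷ s')) ≡⟨ cong decShape (drop-++ʳ s (suc d)) ⟩
    decShape (drop d s')                            ≡⟨ ih' d ⟩
    dropT d (decShape s')                           ≡⟨ dropT-right {decShape s} {decShape s'} d (cong (λ n → suc (n + d)) (sym (size-decShape s))) ⟨
    dropT j (node (decShape s) (decShape s'))       ≡⟨ cong (dropT j) (decShape-++-∷ s s' s< s'≤) ⟨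
    dropT j (decShape (s ++ m ∷ s'))                ∎
    where open ≡-Reasoning

decShape-insert-maximum : ∀ {m} q c → All (_< m) q → decShape (take c q ++ m ∷ drop c q) ≡ splitT c (decShape q)
decShape-insert-maximum q c q< = begin
  decShape (take c q ++ _ ∷ drop c q)           ≡⟨ decShape-++-∷ (take c q) (drop c q) (take⁺ c q<) (drop⁺ c (All.map <⇒≤ q<)) ⟩
  node (decShape (take c q)) (decShape (drop c q)) ≡⟨ cong₂ node (decShape-take q c) (decShape-drop q c) ⟩
  splitT c (decShape q)                          ∎
  where open ≡-Reasoning

bit : Bool → ℕ
bit b = if b then 1 else 0

bit≤1 : ∀ b → bit b ≤ 1
bit≤1 true  = ≤-refl
bit≤1 false = z≤n

<ᵇ-suc : ∀ x b → bit (x <ᵇ suc b) ≡ bit (x <ᵇ b) + bit (x ≡ᵇ b)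
<ᵇ-suc zero    zero    = refl
<ᵇ-suc zero    (suc b) = refl
<ᵇ-suc (suc x) zero    = refl
<ᵇ-suc (suc x) (suc b) = <ᵇ-suc x b

countLess-∷ʳ : ∀ b u a → countLess b (u ++ a ∷ []) ≡ countLess b u + bit (a <ᵇ b)
countLess-∷ʳ b []      a = +-identityʳ (bit (a <ᵇ b))
countLess-∷ʳ b (x ∷ u) a = trans (cong (bit (x <ᵇ b) +_) (countLess-∷ʳ b u a)) (sym (+-assoc (bit (x <ᵇ b)) _ _))

countLess-suc : ∀ b u → countLess (suc b) u ≡ countLess b u + count b u
countLess-suc b []      = refl
countLess-suc b (x ∷ u) =
  trans (cong₂ _+_ (<ᵇ-suc x b) (countLess-suc b u)) (interchange (bit (x <ᵇ b)) (bit (x ≡ᵇ b)) _ _)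

countLess-mono : ∀ {b c} u → b ≤ c → countLess b u ≤ countLess c u
countLess-mono []      b≤c = z≤n
countLess-mono {b} {c} (x ∷ u) b≤c = +-mono-≤ bit-mono (countLess-mono u b≤c)
  where
  bit-mono : bit (x <ᵇ b) ≤ bit (x <ᵇ c)
  bit-mono with x <? b
  ... | yes x<b rewrite <⇒<ᵇ≡true x<b | <⇒<ᵇ≡true (≤-trans x<b b≤c) = ≤-refl
  ... | no  x≮b rewrite ≥⇒<ᵇ≡false (≮⇒≥ x≮b) = z≤n

countLess≤length : ∀ b u → countLess b u ≤ length u
countLess≤length b []      = z≤n
countLess≤length b (x ∷ u) = +-mono-≤ (bit≤1 (x <ᵇ b)) (countLess≤length b u)

countLess-zero : ∀ u → countLess 0 u ≡ 0
countLess-zero []      = refl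
countLess-zero (x ∷ u) = countLess-zero u

count-zero : ∀ u → IsWord u → count 0 u ≡ 0
count-zero []      []             = refl
count-zero (x ∷ u) (1≤x ∷ 1≤u) rewrite ≢⇒≡ᵇ≡false (≢-sym (<⇒≢ 1≤x)) = count-zero u 1≤u

countLess-sameWeight : ∀ {u v} → IsWord u → IsWord v → SameWeight u v → ∀ b → countLess b u ≡ countLess b v
countLess-sameWeight {u} {v} wu wv same zero    = trans (countLess-zero u) (sym (countLess-zero v))
countLess-sameWeight {u} {v} wu wv same (suc b) = begin
  countLess (suc b) u       ≡⟨ countLess-suc b u ⟩
  countLess b u + count b u ≡⟨ cong₂ _+_ (countLess-sameWeight wu wv same b) (count-equal b) ⟩
  countLess b v + count b v ≡⟨ countLess-suc b v ⟨
  countLess (suc b) v       ∎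
  where
  open ≡-Reasoning
  count-equal : ∀ b → count b u ≡ count b v
  count-equal zero    = trans (count-zero u wu) (sym (count-zero v wv))
  count-equal (suc b) = same (suc b) (s≤s z≤n)

bump : ℕ → ℕ → ℕ
bump k v = if v <ᵇ k then v else suc v

bump-< : ∀ {k v} → v < k → bump k v ≡ v
bump-< v<k rewrite <⇒<ᵇ≡true v<k = refl

bump-≥ : ∀ {k v} → k ≤ v → bump k v ≡ suc v
bump-≥ k≤v rewrite ≥⇒<ᵇ≡false k≤v = refl

bump-≡ᵇ-below : ∀ {k j} v → j < k → (bump k v ≡ᵇ j) ≡ (v ≡ᵇ j)
bump-≡ᵇ-below {k} {j} v j<k with v <? k
... | yes v<k = cong (_≡ᵇ j) (bump-< v<k)
... | no  v≮k = begin
  bump k v ≡ᵇ j ≡⟨ cong (_≡ᵇ j) (bump-≥ (≮⇒≥ v≮k)) ⟩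
  suc v ≡ᵇ j    ≡⟨ ≢⇒≡ᵇ≡false (≢-sym (<⇒≢ (≤-trans j<k (≤-trans (≮⇒≥ v≮k) (n≤1+n v))))) ⟩
  false         ≡⟨ ≢⇒≡ᵇ≡false (≢-sym (<⇒≢ (≤-trans j<k (≮⇒≥ v≮k)))) ⟨
  v ≡ᵇ j        ∎
  where open ≡-Reasoning

bump-≡ᵇ-above : ∀ {k i} v → k ≤ i → (bump k v ≡ᵇ suc i) ≡ (v ≡ᵇ i)
bump-≡ᵇ-above {k} {i} v k≤i with v <? k
... | no  v≮k = cong (_≡ᵇ suc i) (bump-≥ (≮⇒≥ v≮k))
... | yes v<k = begin
  bump k v ≡ᵇ suc i ≡⟨ cong (_≡ᵇ suc i) (bump-< v<k) ⟩
  v ≡ᵇ suc i        ≡⟨ ≢⇒≡ᵇ≡false (<⇒≢ (≤-trans v<k (≤-trans k≤i (n≤1+n i)))) ⟩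
  false             ≡⟨ ≢⇒≡ᵇ≡false (<⇒≢ (≤-trans v<k k≤i)) ⟨
  v ≡ᵇ i            ∎
  where open ≡-Reasoning

bump-≢ : ∀ k v → bump k v ≢ k
bump-≢ k v with v <? k
... | yes v<k = λ eq → <⇒≢ v<k (trans (sym (bump-< v<k)) eq)
... | no  v≮k = λ eq → <⇒≢ (s≤s (≮⇒≥ v≮k)) (sym (trans (sym (bump-≥ (≮⇒≥ v≮k))) eq))

-- x <ᵇ suc y is the test x ≤ y performed by countLess (suc y).
OrderEmbedding : (ℕ → ℕ) → Set
OrderEmbedding f = ∀ x y → (f x <ᵇ suc (f y)) ≡ (x <ᵇ suc y)

bump-orderEmbedding : ∀ k → OrderEmbedding (bump k)
bump-orderEmbedding k x y with x <? k | y <? k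
... | yes x<k | yes y<k = cong₂ (λ x′ y′ → x′ <ᵇ suc y′) (bump-< x<k) (bump-< y<k)
... | no  x≮k | no  y≮k = cong₂ (λ x′ y′ → x′ <ᵇ suc y′) (bump-≥ (≮⇒≥ x≮k)) (bump-≥ (≮⇒≥ y≮k))
... | yes x<k | no  y≮k = begin
  bump k x <ᵇ suc (bump k y) ≡⟨ cong₂ (λ x′ y′ → x′ <ᵇ suc y′) (bump-< x<k) (bump-≥ (≮⇒≥ y≮k)) ⟩
  x <ᵇ suc (suc y)            ≡⟨ <⇒<ᵇ≡true (≤-trans x<y (n≤1+n _)) ⟩
  true                        ≡⟨ <⇒<ᵇ≡true x<y ⟨
  x <ᵇ suc y                  ∎
  where
  open ≡-Reasoning
  x<y : x < suc y
  x<y = ≤-trans x<k (≤-trans (≮⇒≥ y≮k) (n≤1+n y))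
... | no  x≮k | yes y<k = begin
  bump k x <ᵇ suc (bump k y) ≡⟨ cong₂ (λ x′ y′ → x′ <ᵇ suc y′) (bump-≥ (≮⇒≥ x≮k)) (bump-< y<k) ⟩
  suc x <ᵇ suc y              ≡⟨ ≥⇒<ᵇ≡false (≤-trans y<x (n≤1+n x)) ⟩
  false                       ≡⟨ ≥⇒<ᵇ≡false y<x ⟨
  x <ᵇ suc y                  ∎
  where
  open ≡-Reasoning
  y<x : y < x
  y<x = ≤-trans y<k (≮⇒≥ x≮k)

-- Standardization of u a

rank : Word → Word → ℕ → ℕ
rank U pre y = suc (countLess y U + count y pre)

newRank : ℕ → Word → ℕ
newRank a U = suc (countLess (suc a) U)

-- The invariant of std u = std-aux u [] u: pre is the part of u already read (reversed).
record FitsIn (U pre xs : Word) : Set where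
  constructor fitsIn
  field count≤ : ∀ x → count x pre + count x xs ≤ count x U

FitsIn-step : ∀ {U pre y ys} → FitsIn U pre (y ∷ ys) → FitsIn U (y ∷ pre) ys
FitsIn-step {U} {pre} {y} {ys} (fitsIn count≤) = fitsIn λ x →
  subst (_≤ count x U) (sym (xy∙z≈y∙xz (bit (y ≡ᵇ x)) (count x pre) (count x ys))) (count≤ x)

FitsIn-pending : ∀ {U pre y ys} → FitsIn U pre (y ∷ ys) → count y pre < count y U
FitsIn-pending {U} {pre} {y} {ys} (fitsIn count≤) = ≤-trans pre<pre+y (count≤ y)
  where
  pre<pre+y : count y pre < count y pre + (bit (y ≡ᵇ y) + count y ys)
  pre<pre+y rewrite ≡ᵇ-refl y = ≤-trans (s≤s (m≤m+n _ _)) (≤-reflexive (sym (+-suc (count y pre) _)))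

module _ (a : ℕ) (U : Word) where

  newRank-≤-rank : ∀ {pre y} → a < y → newRank a U ≤ rank U pre y
  newRank-≤-rank a<y = s≤s (≤-trans (countLess-mono U a<y) (m≤m+n _ _))

  rank-<-newRank : ∀ {pre y} → count y pre < count y U → y ≤ a → rank U pre y < newRank a U
  rank-<-newRank {pre} {y} pending y≤a = s≤s (begin-strict
    countLess y U + count y pre <⟨ +-monoʳ-< (countLess y U) pending ⟩
    countLess y U + count y U   ≡⟨ countLess-suc y U ⟨
    countLess (suc y) U         ≤⟨ countLess-mono U (s≤s y≤a) ⟩
    countLess (suc a) U         ∎)
    where open ≤-Reasoning

  rank-snoc : ∀ {pre y} → count y pre < count y U → rank (U ++ a ∷ []) pre y ≡ bump (newRank a U) (rank U pre y)
  rank-snoc {pre} {y} pending with a <? y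
  ... | yes a<y = begin
    suc (countLess y (U ++ a ∷ []) + count y pre) ≡⟨ cong (λ n → suc (n + count y pre)) (countLess-∷ʳ y U a) ⟩
    suc (countLess y U + bit (a <ᵇ y) + count y pre) ≡⟨ cong (λ t → suc (countLess y U + bit t + count y pre)) (<⇒<ᵇ≡true a<y) ⟩
    suc (countLess y U + 1 + count y pre)         ≡⟨ cong suc (trans (+-assoc (countLess y U) 1 _) (+-suc (countLess y U) _)) ⟩
    suc (rank U pre y)                            ≡⟨ bump-≥ (newRank-≤-rank {pre} a<y) ⟨
    bump (newRank a U) (rank U pre y)             ∎
    where open ≡-Reasoning
  ... | no a≮y = begin
    suc (countLess y (U ++ a ∷ []) + count y pre) ≡⟨ cong (λ n → suc (n + count y pre)) (countLess-∷ʳ y U a) ⟩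
    suc (countLess y U + bit (a <ᵇ y) + count y pre) ≡⟨ cong (λ t → suc (countLess y U + bit t + count y pre)) (≥⇒<ᵇ≡false (≮⇒≥ a≮y)) ⟩
    suc (countLess y U + 0 + count y pre)         ≡⟨ cong (λ n → suc (n + count y pre)) (+-identityʳ (countLess y U)) ⟩
    rank U pre y                                  ≡⟨ bump-< (rank-<-newRank {pre} pending (≮⇒≥ a≮y)) ⟨
    bump (newRank a U) (rank U pre y)             ∎
    where open ≡-Reasoning

  bump-rank-≤-newRank : ∀ {pre y} → count y pre < count y U →
                        (bump (newRank a U) (rank U pre y) <ᵇ suc (newRank a U)) ≡ (y <ᵇ suc a)
  bump-rank-≤-newRank {pre} {y} pending with a <? y
  ... | yes a<y = begin
    bump (newRank a U) (rank U pre y) <ᵇ suc (newRank a U) ≡⟨ cong (_<ᵇ suc (newRank a U)) (bump-≥ (newRank-≤-rank {pre} a<y)) ⟩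
    suc (rank U pre y) <ᵇ suc (newRank a U)               ≡⟨ ≥⇒<ᵇ≡false (s≤s (newRank-≤-rank {pre} a<y)) ⟩
    false                                                 ≡⟨ ≥⇒<ᵇ≡false a<y ⟨
    y <ᵇ suc a                                            ∎
    where open ≡-Reasoning
  ... | no a≮y = begin
    bump (newRank a U) (rank U pre y) <ᵇ suc (newRank a U) ≡⟨ cong (_<ᵇ suc (newRank a U)) (bump-< r<K) ⟩
    rank U pre y <ᵇ suc (newRank a U)                     ≡⟨ <⇒<ᵇ≡true (≤-trans r<K (n≤1+n _)) ⟩
    true                                                  ≡⟨ <⇒<ᵇ≡true (s≤s (≮⇒≥ a≮y)) ⟨
    y <ᵇ suc a                                            ∎
    where
    open ≡-Reasoning
    r<K : rank U pre y < newRank a U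
    r<K = rank-<-newRank {pre} pending (≮⇒≥ a≮y)

  std-aux-extend : ∀ pre xs → FitsIn U pre xs →
                   std-aux (U ++ a ∷ []) pre xs ≡ map (bump (newRank a U)) (std-aux U pre xs)
  std-aux-extend pre []       fits = refl
  std-aux-extend pre (y ∷ ys) fits =
    cong₂ _∷_ (rank-snoc {pre} (FitsIn-pending fits)) (std-aux-extend (y ∷ pre) ys (FitsIn-step fits))

  countLess-bump-std-aux : ∀ pre xs → FitsIn U pre xs →
    countLess (suc (newRank a U)) (map (bump (newRank a U)) (std-aux U pre xs)) ≡ countLess (suc a) xs
  countLess-bump-std-aux pre []       fits = refl
  countLess-bump-std-aux pre (y ∷ ys) fits =
    cong₂ _+_ (cong bit (bump-rank-≤-newRank {pre} (FitsIn-pending fits))) (countLess-bump-std-aux (y ∷ pre) ys (FitsIn-step fits))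

std-aux-∷ʳ : ∀ U pre xs a →
  std-aux U pre (xs ++ a ∷ []) ≡ std-aux U pre xs ++ suc (countLess a U + (count a pre + count a xs)) ∷ []
std-aux-∷ʳ U pre []       a = cong (λ n → suc (countLess a U + n) ∷ []) (sym (+-identityʳ (count a pre)))
std-aux-∷ʳ U pre (x ∷ xs) a = cong (suc (countLess x U + count x pre) ∷_) (trans (std-aux-∷ʳ U (x ∷ pre) xs a)
  (cong (λ n → std-aux U (x ∷ pre) xs ++ suc (countLess a U + n) ∷ []) (xy∙z≈y∙xz (bit (x ≡ᵇ a)) (count a pre) (count a xs))))

fitsIn-std : ∀ u → FitsIn u [] u
fitsIn-std u = fitsIn λ _ → ≤-refl

std-∷ʳ : ∀ u a → std (u ++ a ∷ []) ≡ map (bump (newRank a u)) (std u) ++ newRank a u ∷ []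
std-∷ʳ u a = begin
  std-aux (u ++ a ∷ []) [] (u ++ a ∷ [])
    ≡⟨ std-aux-∷ʳ (u ++ a ∷ []) [] u a ⟩
  std-aux (u ++ a ∷ []) [] u ++ suc (countLess a (u ++ a ∷ []) + count a u) ∷ []
    ≡⟨ cong₂ (λ p k → p ++ k ∷ []) (std-aux-extend a u [] u (fitsIn-std u)) (cong suc last-rank) ⟩
  map (bump (newRank a u)) (std u) ++ newRank a u ∷ [] ∎
  where
  open ≡-Reasoning
  last-rank : countLess a (u ++ a ∷ []) + count a u ≡ countLess (suc a) u
  last-rank = begin
    countLess a (u ++ a ∷ []) + count a u       ≡⟨ cong (_+ count a u) (countLess-∷ʳ a u a) ⟩
    countLess a u + bit (a <ᵇ a) + count a u    ≡⟨ cong (λ b → countLess a u + bit b + count a u) (≥⇒<ᵇ≡false (≤-refl {a})) ⟩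
    countLess a u + 0 + count a u               ≡⟨ cong (_+ count a u) (+-identityʳ (countLess a u)) ⟩
    countLess a u + count a u                   ≡⟨ countLess-suc a u ⟨
    countLess (suc a) u                         ∎

countLess-std-∷ʳ : ∀ u a → countLess (suc (newRank a u)) (map (bump (newRank a u)) (std u)) ≡ countLess (suc a) u
countLess-std-∷ʳ u a = countLess-bump-std-aux a u [] u (fitsIn-std u)

length-std-aux : ∀ U pre xs → length (std-aux U pre xs) ≡ length xs
length-std-aux U pre []       = refl
length-std-aux U pre (x ∷ xs) = cong suc (length-std-aux U (x ∷ pre) xs)

length-std : ∀ u → length (std u) ≡ length u
length-std u = length-std-aux u [] u

countLess≤length-std : ∀ b u → countLess b u ≤ length (std u)
countLess≤length-std b u = subst (countLess b u ≤_) (sym (length-std u)) (countLess≤length b u)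

positionOf-map : ∀ (f : ℕ → ℕ) {j j'} p → (∀ v → (f v ≡ᵇ j) ≡ (v ≡ᵇ j')) → positionOf j (map f p) ≡ positionOf j' p
positionOf-map f []      f≡ = refl
positionOf-map f (x ∷ p) f≡ rewrite f≡ x | positionOf-map f p f≡ = refl

positionOf-++ˡ : ∀ j xs ys → positionOf j xs ≤ length xs → positionOf j (xs ++ ys) ≡ positionOf j xs
positionOf-++ˡ j (x ∷ xs) ys j∈ with x ≡ᵇ j
... | true  = refl
... | false = cong suc (positionOf-++ˡ j xs ys (≤-pred j∈))

positionOf-++ʳ : ∀ j xs ys → All (_≢ j) xs → positionOf j (xs ++ ys) ≡ length xs + positionOf j ys
positionOf-++ʳ j []       ys []           = refl
positionOf-++ʳ j (x ∷ xs) ys (x≢j ∷ j∉xs) rewrite ≢⇒≡ᵇ≡false x≢j = cong suc (positionOf-++ʳ j xs ys j∉xs)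

CoversRange : Word → Set
CoversRange p = ∀ {i} → i < length p → positionOf (suc i) p ≤ length p

inverse≡applyUpTo : ∀ w → inverse w ≡ applyUpTo (λ i → positionOf (suc i) w) (length w)
inverse≡applyUpTo w = map-upTo (λ i → positionOf (suc i) w) (length w)

inverse-bounded : ∀ p → CoversRange p → All (_< suc (length p)) (inverse p)
inverse-bounded p covers = subst (All _) (sym (inverse≡applyUpTo p)) (applyUpTo⁺₁ _ (length p) (s≤s ∘ covers))

-- With p = std u and c = countLess (suc a) u, the word w below is std (u a).
module SnocPermutation (p : Word) (c : ℕ) (covers : CoversRange p) (c≤n : c ≤ length p) where

  n = length p
  w = map (bump (suc c)) p ++ suc c ∷ []

  length-w : length w ≡ suc n
  length-w = trans (length-++ (map (bump (suc c)) p)) (trans (cong (_+ 1) (length-map (bump (suc c)) p)) (+-comm n 1))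

  position-old : ∀ {i} j → (∀ v → (bump (suc c) v ≡ᵇ j) ≡ (v ≡ᵇ suc i)) → i < n → positionOf j w ≡ positionOf (suc i) p
  position-old {i} j bump≡ i<n = begin
    positionOf j w                        ≡⟨ positionOf-++ˡ j (map (bump (suc c)) p) (suc c ∷ []) j∈ ⟩
    positionOf j (map (bump (suc c)) p) ≡⟨ positionOf-map (bump (suc c)) p bump≡ ⟩
    positionOf (suc i) p                  ∎
    where
    open ≡-Reasoning
    j∈ : positionOf j (map (bump (suc c)) p) ≤ length (map (bump (suc c)) p)
    j∈ = subst₂ _≤_ (sym (positionOf-map (bump (suc c)) p bump≡)) (sym (length-map (bump (suc c)) p)) (covers i<n)

  position-below : ∀ {i} → i < c → positionOf (suc i) w ≡ positionOf (suc i) p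
  position-below i<c = position-old _ (λ v → bump-≡ᵇ-below v (s≤s i<c)) (≤-trans i<c c≤n)

  position-above : ∀ {i} → c ≤ i → i < n → positionOf (suc (suc i)) w ≡ positionOf (suc i) p
  position-above c≤i = position-old _ (λ v → bump-≡ᵇ-above v (s≤s c≤i))

  position-new : positionOf (suc c) w ≡ suc n
  position-new = begin
    positionOf (suc c) w                                              ≡⟨ positionOf-++ʳ (suc c) _ _ (map⁺ (All.universal (bump-≢ (suc c)) p)) ⟩
    length (map (bump (suc c)) p) + positionOf (suc c) (suc c ∷ []) ≡⟨ cong₂ _+_ (length-map (bump (suc c)) p) (cong (λ b → if b then 1 else 2) (≡ᵇ-refl (suc c))) ⟩
    n + 1                                                             ≡⟨ +-comm n 1 ⟩
    suc n                                                             ∎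
    where open ≡-Reasoning

  covers-w : CoversRange w
  covers-w {i} i<w = subst (positionOf (suc i) w ≤_) (sym length-w) (bounded i (subst (i <_) length-w i<w))
    where
    bounded : ∀ i → i < suc n → positionOf (suc i) w ≤ suc n
    bounded i i<1+n with <-cmp i c
    ... | tri< i<c _ _ = ≤-trans (≤-reflexive (position-below i<c)) (≤-trans (covers (≤-trans i<c c≤n)) (n≤1+n n))
    ... | tri≈ _ refl _ = ≤-reflexive position-new
    bounded (suc i) i<1+n | tri> _ _ c<1+i =
      ≤-trans (≤-reflexive (position-above (≤-pred c<1+i) (≤-pred i<1+n))) (≤-trans (covers (≤-pred i<1+n)) (n≤1+n n))

  inverse-w : inverse w ≡ take c (inverse p) ++ suc n ∷ drop c (inverse p)
  inverse-w = begin
    inverse w                                   ≡⟨ inverse≡applyUpTo w ⟩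
    applyUpTo g (length w)                      ≡⟨ cong (applyUpTo g) (trans length-w (trans (cong suc (sym c+d≡n)) (sym (+-suc c d)))) ⟩
    applyUpTo g (c + suc d)                     ≡⟨ applyUpTo-+ g c (suc d) ⟩
    applyUpTo g c ++ applyUpTo (g ∘ (c +_)) (suc d)
      ≡⟨ cong₂ _++_ (applyUpTo-cong c position-below)
           (cong₂ _∷_ (trans (cong g (+-identityʳ c)) position-new)
                      (applyUpTo-cong d (λ {i} i<d → trans (cong g (+-suc c i)) (position-above (m≤m+n c i) (c+i<n i<d))))) ⟩
    A ++ suc n ∷ B                              ≡⟨ cong₂ (λ xs ys → xs ++ suc n ∷ ys) take-c drop-c ⟨
    take c (A ++ B) ++ suc n ∷ drop c (A ++ B) ≡⟨ cong (λ q → take c q ++ suc n ∷ drop c q) inverse-p ⟨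
    take c (inverse p) ++ suc n ∷ drop c (inverse p) ∎
    where
    open ≡-Reasoning
    g h : ℕ → ℕ
    g i = positionOf (suc i) w
    h i = positionOf (suc i) p
    d = n ∸ c
    c+d≡n : c + d ≡ n
    c+d≡n = m+[n∸m]≡n c≤n
    c+i<n : ∀ {i} → i < d → c + i < n
    c+i<n i<d = subst (_ <_) c+d≡n (+-monoʳ-< c i<d)
    A B : List ℕ
    A = applyUpTo h c
    B = applyUpTo (h ∘ (c +_)) d
    inverse-p : inverse p ≡ A ++ B
    inverse-p = trans (inverse≡applyUpTo p) (trans (cong (applyUpTo h) (sym c+d≡n)) (applyUpTo-+ h c d))
    take-c : take c (A ++ B) ≡ A
    take-c = subst (λ m → take m (A ++ B) ≡ A) (length-applyUpTo h c) (take-length-++ A)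
    drop-c : drop c (A ++ B) ≡ B
    drop-c = subst (λ m → drop m (A ++ B) ≡ B) (length-applyUpTo h c) (drop-length-++ A)

covers-std : ∀ u → CoversRange (std u)
covers-std = snoc-induction (CoversRange ∘ std) (λ ()) step
  where
  step : ∀ u a → CoversRange (std u) → CoversRange (std (u ++ a ∷ []))
  step u a covers = subst CoversRange (sym (std-∷ʳ u a))
    (SnocPermutation.covers-w (std u) (countLess (suc a) u) covers (countLess≤length-std (suc a) u))

-- The shape σsylv

σsylv-∷ʳ : ∀ u a → σsylv (u ++ a ∷ []) ≡ splitT (countLess (suc a) u) (σsylv u)
σsylv-∷ʳ u a = begin
  decShape (inverse (std (u ++ a ∷ [])))                   ≡⟨ cong (decShape ∘ inverse) (std-∷ʳ u a) ⟩
  decShape (inverse (map (bump (suc c)) p ++ suc c ∷ []))  ≡⟨ cong decShape Snoc.inverse-w ⟩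
  decShape (take c q ++ suc (length p) ∷ drop c q)          ≡⟨ decShape-insert-maximum q c (inverse-bounded p (covers-std u)) ⟩
  splitT c (decShape q)                                     ∎
  where
  open ≡-Reasoning
  c = countLess (suc a) u
  p = std u
  q = inverse p
  module Snoc = SnocPermutation p c (covers-std u) (countLess≤length-std (suc a) u)

countLess-map : ∀ {f} → OrderEmbedding f → ∀ a w → countLess (suc (f a)) (map f w) ≡ countLess (suc a) w
countLess-map f≤ a []      = refl
countLess-map f≤ a (x ∷ w) = cong₂ _+_ (cong bit (f≤ x a)) (countLess-map f≤ a w)

σsylv-map : ∀ {f} → OrderEmbedding f → ∀ w → σsylv (map f w) ≡ σsylv w
σsylv-map {f} f≤ = snoc-induction (λ w → σsylv (map f w) ≡ σsylv w) refl step
  where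
  step : ∀ w a → σsylv (map f w) ≡ σsylv w → σsylv (map f (w ++ a ∷ [])) ≡ σsylv (w ++ a ∷ [])
  step w a ih = begin
    σsylv (map f (w ++ a ∷ []))                                     ≡⟨ cong σsylv (map-++ f w (a ∷ [])) ⟩
    σsylv (map f w ++ f a ∷ [])                                     ≡⟨ σsylv-∷ʳ (map f w) (f a) ⟩
    splitT (countLess (suc (f a)) (map f w)) (σsylv (map f w))    ≡⟨ cong₂ splitT (countLess-map f≤ a w) ih ⟩
    splitT (countLess (suc a) w) (σsylv w)                          ≡⟨ σsylv-∷ʳ w a ⟨
    σsylv (w ++ a ∷ [])                                             ∎
    where open ≡-Reasoning

σsylv-std : ∀ u → σsylv (std u) ≡ σsylv u
σsylv-std = snoc-induction (λ u → σsylv (std u) ≡ σsylv u) refl step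
  where
  step : ∀ u a → σsylv (std u) ≡ σsylv u → σsylv (std (u ++ a ∷ [])) ≡ σsylv (u ++ a ∷ [])
  step u a ih = begin
    σsylv (std (u ++ a ∷ []))                       ≡⟨ cong σsylv (std-∷ʳ u a) ⟩
    σsylv (map (bump K) (std u) ++ K ∷ [])          ≡⟨ σsylv-∷ʳ (map (bump K) (std u)) K ⟩
    splitT (countLess (suc K) (map (bump K) (std u))) (σsylv (map (bump K) (std u)))
      ≡⟨ cong₂ splitT (countLess-std-∷ʳ u a) (trans (σsylv-map (bump-orderEmbedding K) (std u)) ih) ⟩
    splitT (countLess (suc a) u) (σsylv u)          ≡⟨ σsylv-∷ʳ u a ⟨
    σsylv (u ++ a ∷ [])                             ∎
    where
    open ≡-Reasoning
    K = newRank a u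

size-σsylv : ∀ u → size (σsylv u) ≡ length u
size-σsylv u = begin
  size (decShape (inverse (std u))) ≡⟨ size-decShape (inverse (std u)) ⟩
  length (inverse (std u))          ≡⟨ cong length (inverse≡applyUpTo (std u)) ⟩
  length (applyUpTo _ (length (std u))) ≡⟨ length-applyUpTo _ (length (std u)) ⟩
  length (std u)                    ≡⟨ length-std u ⟩
  length u                          ∎
  where open ≡-Reasoning

σsylv-∷ : ∀ a u → σsylv (a ∷ u) ≡ insertT (countLess a u) (σsylv u)
σsylv-∷ a = snoc-induction (λ u → σsylv (a ∷ u) ≡ insertT (countLess a u) (σsylv u)) (σsylv-∷ʳ [] a) step
  where
  step : ∀ u b → σsylv (a ∷ u) ≡ insertT (countLess a u) (σsylv u) →
         σsylv (a ∷ u ++ b ∷ []) ≡ insertT (countLess a (u ++ b ∷ [])) (σsylv (u ++ b ∷ []))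
  step u b ih = begin
    σsylv (a ∷ u ++ b ∷ [])                                ≡⟨ σsylv-∷ʳ (a ∷ u) b ⟩
    splitT (bit (a <ᵇ suc b) + c) (σsylv (a ∷ u))           ≡⟨ cong (splitT (bit (a <ᵇ suc b) + c)) ih ⟩
    splitT (bit (a <ᵇ suc b) + c) (insertT k (σsylv u))     ≡⟨ split-insert ⟩
    insertT (k + bit (b <ᵇ a)) (splitT c (σsylv u))         ≡⟨ cong₂ insertT (countLess-∷ʳ a u b) (σsylv-∷ʳ u b) ⟨
    insertT (countLess a (u ++ b ∷ [])) (σsylv (u ++ b ∷ [])) ∎
    where
    open ≡-Reasoning
    c = countLess (suc b) u
    k = countLess a u
    c≤size : c ≤ size (σsylv u)
    c≤size = subst (c ≤_) (sym (size-σsylv u)) (countLess≤length (suc b) u)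
    split-insert : splitT (bit (a <ᵇ suc b) + c) (insertT k (σsylv u)) ≡ insertT (k + bit (b <ᵇ a)) (splitT c (σsylv u))
    split-insert with b <? a
    ... | yes b<a rewrite ≥⇒<ᵇ≡false b<a | <⇒<ᵇ≡true b<a | +-comm k 1 =
      splitT-insertT-≥ k c (σsylv u) (countLess-mono u b<a) c≤size
    ... | no  b≮a rewrite <⇒<ᵇ≡true (s≤s (≮⇒≥ b≮a)) | ≥⇒<ᵇ≡false (≮⇒≥ b≮a) | +-identityʳ k =
      splitT-insertT-≤ k c (σsylv u) (countLess-mono u (≤-trans (≮⇒≥ b≮a) (n≤1+n b))) c≤size

proposition8 : IsAbstractShape σsylv
proposition8 = (λ u _ → sym (σsylv-std u)) , append-letter
  where
  append-letter : ∀ u v a → IsWord u → IsWord v → 1 ≤ a → SameWeight u v → σsylv u ≡ σsylv v →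
                  (σsylv (u ++ a ∷ []) ≡ σsylv (v ++ a ∷ [])) × (σsylv (a ∷ u) ≡ σsylv (a ∷ v))
  append-letter u v a wu wv _ same σ≡ =
      (begin
        σsylv (u ++ a ∷ [])                     ≡⟨ σsylv-∷ʳ u a ⟩
        splitT (countLess (suc a) u) (σsylv u) ≡⟨ cong₂ splitT (countLess-sameWeight wu wv same (suc a)) σ≡ ⟩
        splitT (countLess (suc a) v) (σsylv v) ≡⟨ σsylv-∷ʳ v a ⟨
        σsylv (v ++ a ∷ [])                     ∎)
    , (begin
        σsylv (a ∷ u)                            ≡⟨ σsylv-∷ a u ⟩
        insertT (countLess a u) (σsylv u)        ≡⟨ cong₂ insertT (countLess-sameWeight wu wv same a) σ≡ ⟩
        insertT (countLess a v) (σsylv v)        ≡⟨ σsylv-∷ a v ⟨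
        σsylv (a ∷ v)                            ∎)
    where open ≡-Reasoning
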